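{- Let $(X,\mathcal{B})$ be a $t$-$(v,k,1)$-design and let $\tau$ be a positive integer with $k\ge \binom{\tau}{2}(t-1)+1$. Then $(X,\mathcal{B})$ can be used as a distribution design to produce an RTS with threshold $\tau$; that is, there is a positive integer $\sigma$ such that the union of any $\tau$ distinct blocks contains at least $\sigma$ points and the union of any $\tau-1$ blocks contains at most $\sigma-1$ points.
   Context: A $t$-$(v,k,1)$-design is a set system $(X,\mathcal{B})$ with $|X|=v$, every block of size $k$, and every set of $t$ points of $X$ contained in exactly one block. A distribution design $(X,\mathcal{B})$ can be used to produce an RTS with threshold $\tau$ if there exists a positive integer $\sigma$ such that the union of any $\tau$ distinct blocks contains at least $\sigma$ points and the union of any $\tau-1$ blocks contains at most $\sigma-1$ points. -}

module Defs where

open import Data.Nat using (ℕ)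
open import Data.Fin using (Fin)
open import Data.Fin.Subset using (Subset; _⊆_; ∣_∣; ⋃)
open import Data.List using (List)
open import Data.List.Base using (tabulate)
open import Data.Product using (Σ; _×_)
open import Relation.Binary.PropositionalEquality using (_≡_)
open import Function.Definitions using (Injective)

-- A set system on the point set X = Fin v with b blocks, given as an
-- injective (so blocks are distinct, i.e. a set of blocks) family Fin b → Subset v.
record SetSystem (v : ℕ) : Set where
  field
    b     : ℕ
    block : Fin b → Subset v
    distinct : Injective _≡_ _≡_ block
open SetSystem public

IsDesign : (t v k : ℕ) → SetSystem v → Set
IsDesign t v k S =
  ((i : Fin (b S)) → ∣ block S i ∣ ≡ k) ×
  ((T : Subset v) → ∣ T ∣ ≡ t →
     Σ (Fin (b S)) λ i → (T ⊆ block S i) × ((j : Fin (b S)) → T ⊆ block S j → j ≡ i))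

unionOf : {v n : ℕ} → (S : SetSystem v) → (Fin n → Fin (b S)) → Subset v
unionOf {n = n} S f = ⋃ (tabulate {n = n} (λ i → block S (f i)))

module Submission where

-- Take σ = (τ - 1)·k + 1.  Any τ - 1 blocks have k points each, so
-- their union has at most (τ - 1)·k = σ - 1 points.  For τ distinct blocks
-- we use a Bonferroni-type lower bound: if m sets each have at least k
-- points and any two of them share at most μ points, then their union has
-- at least m·k - C(m,2)·μ points.  In a t-(v,k,1)-design two distinct
-- blocks share at most t - 1 points (t common points would lie in two
-- blocks), so τ distinct blocks cover at least τ·k - C(τ,2)·(t - 1) points,
-- which is at least σ exactly when k ≥ C(τ,2)·(t - 1) + 1.

open import Defs
open import Data.Nat using (ℕ; _≤_; _<_; _∸_; _*_; _+_)
open import Data.Nat.Combinatorics using (_C_)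
open import Data.Fin using (Fin)
open import Data.Fin.Subset using (∣_∣)
open import Data.Product using (Σ; _×_)
open import Relation.Binary.PropositionalEquality using (_≡_)
open import Function.Definitions using (Injective)

open import Data.Nat using (zero; suc; z≤n; s≤s; _≤?_)
open import Data.Nat.Properties
  using (+-suc; +-comm; +-assoc; *-distribʳ-+; m≤m+n; +-mono-≤; +-monoˡ-≤; +-monoʳ-≤;
         +-cancelˡ-≤; ≤-reflexive; ≰⇒>; <⇒≤pred; pred[m∸n]≡m∸[1+n]; module ≤-Reasoning)
open import Data.Nat.Combinatorics using (nC1≡n; nCk+nC[k+1]≡[n+1]C[k+1])
import Data.Fin as Fin
open import Data.Fin.Properties using (suc-injective)
open import Data.Fin.Subset using (Subset; _⊆_; _∪_; _∩_; ⊥; inside; outside; ⋃)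
open import Data.Fin.Subset.Properties
  using (out⊆; in⊆in; ⊥⊆; ∣⊥∣≡0; p∩q⊆p; p∩q⊆q; ∩-zeroʳ; ∩-distribˡ-∪)
open import Data.List.Base using (tabulate)
open import Data.Vec using ([]; _∷_)
open import Data.Product using (_,_)
open import Relation.Binary.PropositionalEquality using (refl; cong; sym; trans; subst; module ≡-Reasoning)
open import Relation.Nullary using (yes; no; ¬_)
open import Data.Empty using (⊥-elim)
open import Function.Base using (_∘_)

∣p∪q∣+∣p∩q∣≡∣p∣+∣q∣ : ∀ {n} (p q : Subset n) → ∣ p ∪ q ∣ + ∣ p ∩ q ∣ ≡ ∣ p ∣ + ∣ q ∣
∣p∪q∣+∣p∩q∣≡∣p∣+∣q∣ [] [] = refl
∣p∪q∣+∣p∩q∣≡∣p∣+∣q∣ (outside ∷ p) (outside ∷ q) = ∣p∪q∣+∣p∩q∣≡∣p∣+∣q∣ p q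
∣p∪q∣+∣p∩q∣≡∣p∣+∣q∣ (outside ∷ p) (inside ∷ q) =
  trans (cong suc (∣p∪q∣+∣p∩q∣≡∣p∣+∣q∣ p q)) (sym (+-suc ∣ p ∣ ∣ q ∣))
∣p∪q∣+∣p∩q∣≡∣p∣+∣q∣ (inside ∷ p) (outside ∷ q) = cong suc (∣p∪q∣+∣p∩q∣≡∣p∣+∣q∣ p q)
∣p∪q∣+∣p∩q∣≡∣p∣+∣q∣ (inside ∷ p) (inside ∷ q) = cong suc (begin
  ∣ p ∪ q ∣ + suc ∣ p ∩ q ∣   ≡⟨ +-suc ∣ p ∪ q ∣ ∣ p ∩ q ∣ ⟩
  suc (∣ p ∪ q ∣ + ∣ p ∩ q ∣) ≡⟨ cong suc (∣p∪q∣+∣p∩q∣≡∣p∣+∣q∣ p q) ⟩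
  suc (∣ p ∣ + ∣ q ∣)         ≡⟨ sym (+-suc ∣ p ∣ ∣ q ∣) ⟩
  ∣ p ∣ + suc ∣ q ∣           ∎)
  where open ≡-Reasoning

∣p∪q∣≤∣p∣+∣q∣ : ∀ {n} (p q : Subset n) → ∣ p ∪ q ∣ ≤ ∣ p ∣ + ∣ q ∣
∣p∪q∣≤∣p∣+∣q∣ p q = subst (∣ p ∪ q ∣ ≤_) (∣p∪q∣+∣p∩q∣≡∣p∣+∣q∣ p q) (m≤m+n _ _)

∣r∩[p∪q]∣≤∣r∩p∣+∣r∩q∣ : ∀ {n} (r p q : Subset n) → ∣ r ∩ (p ∪ q) ∣ ≤ ∣ r ∩ p ∣ + ∣ r ∩ q ∣
∣r∩[p∪q]∣≤∣r∩p∣+∣r∩q∣ r p q =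
  subst (_≤ ∣ r ∩ p ∣ + ∣ r ∩ q ∣) (cong ∣_∣ (sym (∩-distribˡ-∪ r p q)))
        (∣p∪q∣≤∣p∣+∣q∣ (r ∩ p) (r ∩ q))

subsetOfSize : ∀ {n} (p : Subset n) (m : ℕ) → m ≤ ∣ p ∣ → Σ (Subset n) λ q → (q ⊆ p) × (∣ q ∣ ≡ m)
subsetOfSize [] zero z≤n = [] , (λ x∈q → x∈q) , refl
subsetOfSize (outside ∷ p) m m≤∣p∣ with subsetOfSize p m m≤∣p∣
... | q , q⊆p , ∣q∣≡m = outside ∷ q , out⊆ q⊆p , ∣q∣≡m
subsetOfSize {suc n} (inside ∷ p) zero _ = ⊥ , ⊥⊆ , ∣⊥∣≡0 (suc n)
subsetOfSize (inside ∷ p) (suc m) (s≤s m≤∣p∣) with subsetOfSize p m m≤∣p∣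
... | q , q⊆p , ∣q∣≡m = inside ∷ q , in⊆in q⊆p , cong suc ∣q∣≡m

⋃[_] : ∀ {n m} → (Fin m → Subset n) → Subset n
⋃[ F ] = ⋃ (tabulate F)

∣⋃F∣≤m*k : ∀ {n m k} (F : Fin m → Subset n) → (∀ i → ∣ F i ∣ ≤ k) → ∣ ⋃[ F ] ∣ ≤ m * k
∣⋃F∣≤m*k {n} {zero} F _ = subst (_≤ 0) (sym (∣⊥∣≡0 n)) z≤n
∣⋃F∣≤m*k {m = suc m} {k} F ∣F∣≤k = begin
  ∣ F Fin.zero ∪ ⋃[ F ∘ Fin.suc ] ∣      ≤⟨ ∣p∪q∣≤∣p∣+∣q∣ (F Fin.zero) ⋃[ F ∘ Fin.suc ] ⟩
  ∣ F Fin.zero ∣ + ∣ ⋃[ F ∘ Fin.suc ] ∣  ≤⟨ +-mono-≤ (∣F∣≤k Fin.zero) (∣⋃F∣≤m*k (F ∘ Fin.suc) (∣F∣≤k ∘ Fin.suc)) ⟩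
  k + m * k                              ∎
  where open ≤-Reasoning

∣A∩⋃F∣≤m*μ : ∀ {n m μ} (A : Subset n) (F : Fin m → Subset n) →
  (∀ i → ∣ A ∩ F i ∣ ≤ μ) → ∣ A ∩ ⋃[ F ] ∣ ≤ m * μ
∣A∩⋃F∣≤m*μ {n} {zero} A F _ = subst (_≤ 0) (sym (trans (cong ∣_∣ (∩-zeroʳ A)) (∣⊥∣≡0 n))) z≤n
∣A∩⋃F∣≤m*μ {m = suc m} {μ} A F ∣A∩F∣≤μ = begin
  ∣ A ∩ (F Fin.zero ∪ ⋃[ F ∘ Fin.suc ]) ∣          ≤⟨ ∣r∩[p∪q]∣≤∣r∩p∣+∣r∩q∣ A (F Fin.zero) ⋃[ F ∘ Fin.suc ] ⟩
  ∣ A ∩ F Fin.zero ∣ + ∣ A ∩ ⋃[ F ∘ Fin.suc ] ∣    ≤⟨ +-mono-≤ (∣A∩F∣≤μ Fin.zero) (∣A∩⋃F∣≤m*μ A (F ∘ Fin.suc) (∣A∩F∣≤μ ∘ Fin.suc)) ⟩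
  μ + m * μ                                        ∎
  where open ≤-Reasoning

[1+m]C2≡m+mC2 : ∀ m → suc m C 2 ≡ m + (m C 2)
[1+m]C2≡m+mC2 m = trans (sym (nCk+nC[k+1]≡[n+1]C[k+1] m 1)) (cong (_+ m C 2) (nC1≡n m))

bonferroni : ∀ {n m k μ} (F : Fin m → Subset n) →
  (∀ i → k ≤ ∣ F i ∣) → (∀ i j → ¬ i ≡ j → ∣ F i ∩ F j ∣ ≤ μ) →
  m * k ≤ ∣ ⋃[ F ] ∣ + (m C 2) * μ
bonferroni {m = zero} F _ _ = z≤n
bonferroni {m = suc m} {k} {μ} F k≤∣F∣ ∣F∩F∣≤μ = begin
  k + m * k                            ≤⟨ +-mono-≤ (k≤∣F∣ Fin.zero) (bonferroni (F ∘ Fin.suc) (k≤∣F∣ ∘ Fin.suc) pairsOfTail) ⟩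
  ∣ A ∣ + (∣ U ∣ + (m C 2) * μ)          ≡⟨ sym (+-assoc ∣ A ∣ ∣ U ∣ ((m C 2) * μ)) ⟩
  (∣ A ∣ + ∣ U ∣) + (m C 2) * μ          ≡⟨ cong (_+ (m C 2) * μ) (sym (∣p∪q∣+∣p∩q∣≡∣p∣+∣q∣ A U)) ⟩
  (∣ A ∪ U ∣ + ∣ A ∩ U ∣) + (m C 2) * μ  ≤⟨ +-monoˡ-≤ ((m C 2) * μ) (+-monoʳ-≤ ∣ A ∪ U ∣ headMeetsTail) ⟩
  (∣ A ∪ U ∣ + m * μ) + (m C 2) * μ      ≡⟨ +-assoc ∣ A ∪ U ∣ (m * μ) ((m C 2) * μ) ⟩
  ∣ A ∪ U ∣ + (m * μ + (m C 2) * μ)      ≡⟨ cong (∣ A ∪ U ∣ +_) (sym (*-distribʳ-+ μ m (m C 2))) ⟩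
  ∣ A ∪ U ∣ + (m + (m C 2)) * μ          ≡⟨ cong (λ c → ∣ A ∪ U ∣ + c * μ) (sym ([1+m]C2≡m+mC2 m)) ⟩
  ∣ A ∪ U ∣ + (suc m C 2) * μ            ∎
  where
  open ≤-Reasoning
  A = F Fin.zero
  U = ⋃[ F ∘ Fin.suc ]
  pairsOfTail : ∀ i j → ¬ i ≡ j → ∣ F (Fin.suc i) ∩ F (Fin.suc j) ∣ ≤ μ
  pairsOfTail i j i≢j = ∣F∩F∣≤μ (Fin.suc i) (Fin.suc j) (i≢j ∘ suc-injective)
  headMeetsTail : ∣ A ∩ U ∣ ≤ m * μ
  headMeetsTail = ∣A∩⋃F∣≤m*μ A (F ∘ Fin.suc) (λ i → ∣F∩F∣≤μ Fin.zero (Fin.suc i) λ ())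

-- In a t-(v,k,1)-design two distinct blocks share at most t - 1 points:
-- t common points would lie in both blocks, contradicting uniqueness.
distinctBlocksMeet : ∀ {t v k} (S : SetSystem v) → IsDesign t v k S →
  ∀ i j → ¬ i ≡ j → ∣ block S i ∩ block S j ∣ ≤ t ∸ 1
distinctBlocksMeet {t} S (_ , uniqueBlock) i j i≢j with t ≤? ∣ block S i ∩ block S j ∣
... | no t≰∣Bi∩Bj∣ = subst (∣ block S i ∩ block S j ∣ ≤_) (pred[m∸n]≡m∸[1+n] t 0) (<⇒≤pred (≰⇒> t≰∣Bi∩Bj∣))
... | yes t≤∣Bi∩Bj∣ with subsetOfSize (block S i ∩ block S j) t t≤∣Bi∩Bj∣
...   | T , T⊆Bi∩Bj , ∣T∣≡t with uniqueBlock T ∣T∣≡t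
...     | _ , _ , onlyBlock = ⊥-elim (i≢j (trans (onlyBlock i (p∩q⊆p _ _ ∘ T⊆Bi∩Bj))
                                               (sym (onlyBlock j (p∩q⊆q _ _ ∘ T⊆Bi∩Bj)))))

cancelOverlap : ∀ {X k c u} → X + 1 ≤ k → k + c ≤ u + X → suc c ≤ u
cancelOverlap {X} {k} {c} {u} X+1≤k k+c≤u+X = +-cancelˡ-≤ X (suc c) u (begin
  X + suc c    ≡⟨ trans (+-suc X c) (cong (_+ c) (+-comm 1 X)) ⟩
  (X + 1) + c  ≤⟨ +-monoˡ-≤ c X+1≤k ⟩
  k + c        ≤⟨ k+c≤u+X ⟩
  u + X        ≡⟨ +-comm u X ⟩
  X + u        ∎)
  where open ≤-Reasoning

theorem3p3 : (t v k : ℕ) (S : SetSystem v) → IsDesign t v k S →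
    (τ : ℕ) → 0 < τ → (τ C 2) * (t ∸ 1) + 1 ≤ k →
    Σ ℕ λ σ → (0 < σ) ×
      (((f : Fin τ → Fin (b S)) → Injective _≡_ _≡_ f → σ ≤ ∣ unionOf S f ∣) ×
       ((g : Fin (τ ∸ 1) → Fin (b S)) → ∣ unionOf S g ∣ ≤ σ ∸ 1))
theorem3p3 t v k S D@(∣B∣≡k , _) (suc n) _ k-large = suc (n * k) , s≤s z≤n , τBlocksLarge , τ-1BlocksSmall
  where
  τBlocksLarge : (f : Fin (suc n) → Fin (b S)) → Injective _≡_ _≡_ f → suc (n * k) ≤ ∣ unionOf S f ∣
  τBlocksLarge f f-inj = cancelOverlap k-large
    (bonferroni (block S ∘ f) (≤-reflexive ∘ sym ∘ ∣B∣≡k ∘ f)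
                (λ i j i≢j → distinctBlocksMeet S D (f i) (f j) (i≢j ∘ f-inj)))
  τ-1BlocksSmall : (g : Fin n → Fin (b S)) → ∣ unionOf S g ∣ ≤ n * k
  τ-1BlocksSmall g = ∣⋃F∣≤m*k (block S ∘ g) (≤-reflexive ∘ ∣B∣≡k ∘ g)
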